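{- Let $\sigma\in\mathfrak S_n$ and $1\le i\le n$. Then $\sigma^{ -1}(i)$ is a right-to-left minimum of $\sigma$ (i.e. $\sigma(\sigma^{ -1}(i))=\min_{l\ge\sigma^{ -1}(i)}\sigma(l)$) if and only if the $i$th step of $\Psi_{FV}(\sigma)$ is a type 1 step.
   Context: A Laguerre history of size $n$ is a Motzkin path of $n$ steps in which each step carries a weight: a step $\nearrow$ starting at height $h$ has weight $yq^i$ for some $i\in\{0,\dots,h\}$; a step $\rightarrow$ starting at height $h$ has weight either $yq^i$ for some $i\in\{0,\dots,h\}$ or $q^i$ for some $i\in\{0,\dots,h-1\}$; a step $\searrow$ starting at height $h$ has weight $q^i$ for some $i\in\{0,\dots,h-1\}$. A type 1 step has weight $yq^h$ and a type 2 step has weight $q^{h-1}$, where $h$ is its starting height. The Françon–Viennot map $\Psi_{FV}$: for $\sigma\in\mathfrak S_n$, use the conventions $\sigma(0)=0$, $\sigma(n+1)=n+1$. For $j\in\{1,\dots,n\}$ and $k=\sigma(j)$, the $k$th step of $\Psi_{FV}(\sigma)$ is $\nearrow$ if $\sigma(j-1)>\sigma(j)<\sigma(j+1)$, $\searrow$ if $\sigma(j-1)<\sigma(j)>\sigma(j+1)$, and $\rightarrow$ otherwise; its weight is $y^\delta q^m$ where $\delta=1$ if $j$ is an ascent ($j=n$ or $\sigma(j)<\sigma(j+1)$) and $0$ otherwise, and $m$ is the number of $l$ with $1\le l$, $l+1<j$ and $\sigma(l+1)<\sigma(j)<\sigma(l)$. -}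

module Defs where

open import Data.Nat using (ℕ; zero; suc; _≤_; _<?_; _<ᵇ_; _≡ᵇ_)
open import Data.Bool using (Bool; true; false; _∧_; _∨_; if_then_else_)
open import Data.Fin using (Fin; toℕ; fromℕ<)
open import Data.Fin.Permutation using (Permutation′; _⟨$⟩ʳ_; _⟨$⟩ˡ_)
open import Data.Integer using (ℤ; +_; -[1+_]; _+_)
open import Data.List using (List; []; _∷_; map; filter; length; upTo; take)
open import Data.List using () renaming (foldr to lfoldr)
open import Data.Vec.Functional using () renaming (toList to vtoList)
open import Data.Product using (_×_)
open import Relation.Binary.PropositionalEquality using (_≡_)
open import Relation.Nullary.Decidable using (yes; no)
open import Relation.Nullary using (Dec)
open import Data.Bool using (T)
open import Data.Bool.Properties using (T?)

-- 1-based extension of σ : Fin n → Fin n to ℕ, with σ(0) = 0 and σ(n+1) = n+1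
-- (values beyond n+1 are irrelevant and also set to n+1).
ext : ∀ {n} → Permutation′ n → ℕ → ℕ
ext σ zero = zero
ext {n} σ (suc j) with j <? n
... | yes p = suc (toℕ (σ ⟨$⟩ʳ fromℕ< p))
... | no _  = suc n

data Step : Set where
  up down flat : Step

kindAt : ∀ {n} → Permutation′ n → ℕ → Step
kindAt σ j =
  if (ext σ (j Data.Nat.∸ 1) <ᵇ ext σ j) ∧ (ext σ (suc j) <ᵇ ext σ j) then down
  else if (ext σ j <ᵇ ext σ (j Data.Nat.∸ 1)) ∧ (ext σ j <ᵇ ext σ (suc j)) then up
  else flat

ascentAt : ∀ {n} → Permutation′ n → ℕ → Bool
ascentAt {n} σ j = (j ≡ᵇ n) ∨ (ext σ j <ᵇ ext σ (suc j))

mAt : ∀ {n} → Permutation′ n → ℕ → ℕ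
mAt σ j = length (filter (λ l → T? (ok l)) (upTo j))
  where
  ok : ℕ → Bool
  ok l = (0 <ᵇ l) ∧ (suc l <ᵇ j) ∧ (ext σ (suc l) <ᵇ ext σ j) ∧ (ext σ j <ᵇ ext σ l)

-- position j = σ⁻¹(k) (1-based) producing the k-th step, for k : Fin n (k-th step = toℕ k + 1)
posOf : ∀ {n} → Permutation′ n → Fin n → ℕ
posOf σ k = suc (toℕ (σ ⟨$⟩ˡ k))

-- the sequence of step kinds of Ψ_FV(σ), in order k = 1..n
pathFV : ∀ {n} → Permutation′ n → List Step
pathFV σ = map (λ k → kindAt σ (posOf σ k)) (vtoList (λ k → k))

stepΔ : Step → ℤ
stepΔ up = + 1
stepΔ down = -[1+ 0 ]
stepΔ flat = + 0

heightBefore : ∀ {n} → Permutation′ n → Fin n → ℤ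
heightBefore σ k = lfoldr (λ s h → stepΔ s + h) (+ 0) (take (toℕ k) (pathFV σ))

-- the k-th step of Ψ_FV(σ) has weight y q^h (h its starting height), i.e. δ = 1 and m = h
IsType1 : ∀ {n} → Permutation′ n → Fin n → Set
IsType1 σ k = (ascentAt σ (posOf σ k) ≡ true) × (+ (mAt σ (posOf σ k)) ≡ heightBefore σ k)

-- position p : Fin n (0-based, i.e. position toℕ p + 1) is a right-to-left minimum:
-- σ(p) = min_{l ≥ p} σ(l)
IsRLMin : ∀ {n} → Permutation′ n → Fin n → Set
IsRLMin {n} σ p = (l : Fin n) → toℕ p ≤ toℕ l → toℕ (σ ⟨$⟩ʳ p) ≤ toℕ (σ ⟨$⟩ʳ l)

-- Write f(0) = 0, f(j) = σ(j), f(n+1) = n+1.  The height of the Françon–Viennot path before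
-- its step of value v equals the number of descents f(l) ≥ v > f(l+1) of f passing through
-- the level v (the count changes by exactly the step's displacement when v increases).
-- For v = f(j) these descents split into those before j, which are what the weight exponent
-- m counts, the one at j itself, which is excluded when j is an ascent, and those after j.
-- So a step is of type 1 iff j is an ascent and no later descent jumps over f(j), and by a
-- discrete intermediate value argument this says exactly that j is a right-to-left minimum.
module Submission where

open import Defs
open import Algebra.Properties.CommutativeSemigroup using (interchange)
open import Data.Bool using (Bool; true; false; _∧_; _∨_; T; if_then_else_)
open import Data.Bool.Properties using (T?; T-≡; ∧-zeroʳ; ∧-identityʳ)
open import Data.Empty using (⊥-elim)
open import Data.Fin using (Fin; toℕ; fromℕ<) renaming (zero to fzero; suc to fsuc)
open import Data.Fin.Properties using (toℕ<n; toℕ-fromℕ<; fromℕ<-toℕ)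
open import Data.Fin.Permutation using (Permutation′; _⟨$⟩ʳ_; _⟨$⟩ˡ_; flip; inverseˡ; inverseʳ)
open import Data.Integer using (ℤ; +_)
import Data.Integer as ℤ
import Data.Integer.Properties as ℤₚ
open import Data.List using (List; length; filter; applyUpTo; take; tabulate; foldr)
open import Data.List.Properties using (map-tabulate)
open import Data.Nat
open import Data.Nat.Properties
open import Data.Product using (_×_; _,_)
open import Data.Sum using (inj₁; inj₂)
open import Function using (_∘_; id)
open import Function.Bundles using (_⇔_; mk⇔; Equivalence)
import Function.Properties.Equivalence as ⇔
open import Relation.Binary.Definitions using (tri<; tri≈; tri>)
open import Relation.Binary.PropositionalEquality
open import Relation.Nullary using (yes; no)
open import Relation.Nullary.Decidable using (dec-true; dec-false)
open ≡-Reasoning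

<ᵇ-true : ∀ {m n} → m < n → (m <ᵇ n) ≡ true
<ᵇ-true {m} {n} = dec-true (m <? n)

<ᵇ-false : ∀ {m n} → n ≤ m → (m <ᵇ n) ≡ false
<ᵇ-false {m} {n} n≤m = dec-false (m <? n) (≤⇒≯ n≤m)

<ᵇ-irrefl : ∀ m → (m <ᵇ m) ≡ false
<ᵇ-irrefl m = <ᵇ-false {m} {m} ≤-refl

<ᵇ⇔< : ∀ {m n} → (m <ᵇ n) ≡ true ⇔ m < n
<ᵇ⇔< {m} {n} = mk⇔ (<ᵇ⇒< m n ∘ Equivalence.from T-≡) <ᵇ-true

<ᵇ-false⇒≥ : ∀ {m n} → (m <ᵇ n) ≡ false → n ≤ m
<ᵇ-false⇒≥ m≮ᵇn = ≮⇒≥ (λ m<n → subst T m≮ᵇn (<⇒<ᵇ m<n))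

≤ᵇ-≢ : ∀ {m n} → m ≢ n → (m ≤ᵇ n) ≡ (m <ᵇ n)
≤ᵇ-≢ {m} {n} m≢n with <-cmp m n
... | tri< m<n _ _ = trans (dec-true (m ≤? n) (<⇒≤ m<n)) (sym (<ᵇ-true m<n))
... | tri≈ _ m≡n _ = ⊥-elim (m≢n m≡n)
... | tri> _ _ n<m = trans (dec-false (m ≤? n) (<⇒≱ n<m)) (sym (<ᵇ-false (<⇒≤ n<m)))

<ᵇ-suc : ∀ m n → (m <ᵇ suc n) ≡ (m ≤ᵇ n)
<ᵇ-suc zero    n = refl
<ᵇ-suc (suc m) n = refl

≤ᵇ-refl : ∀ m → (m ≤ᵇ m) ≡ true
≤ᵇ-refl m = dec-true (m ≤? m) ≤-refl

≡ᵇ-refl : ∀ m → (m ≡ᵇ m) ≡ true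
≡ᵇ-refl m = dec-true (m ≟ m) refl

≡ᵇ-≢ : ∀ {m n} → m ≢ n → (m ≡ᵇ n) ≡ false
≡ᵇ-≢ {m} {n} = dec-false (m ≟ n)

+m≡+[m+r]⇔r≡0 : ∀ {m r} → + m ≡ + (m + r) ⇔ r ≡ 0
+m≡+[m+r]⇔r≡0 {m} {r} = mk⇔
  (λ m≡m+r → sym (+-cancelˡ-≡ m 0 r (trans (+-identityʳ m) (ℤₚ.+-injective m≡m+r))))
  (λ r≡0 → cong +_ (sym (trans (cong (_+_ m) r≡0) (+-identityʳ m))))

indicator : Bool → ℕ
indicator false = 0
indicator true  = 1

sum< : ℕ → (ℕ → ℕ) → ℕ
sum< zero    g = 0
sum< (suc N) g = g 0 + sum< N (g ∘ suc)

count : ℕ → (ℕ → Bool) → ℕ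
count N p = sum< N (indicator ∘ p)

sum<-cong : ∀ N {g h : ℕ → ℕ} → (∀ {l} → l < N → g l ≡ h l) → sum< N g ≡ sum< N h
sum<-cong zero    g≗h = refl
sum<-cong (suc N) g≗h = cong₂ _+_ (g≗h z<s) (sum<-cong N (g≗h ∘ s<s))

sum<-+ : ∀ N (g h : ℕ → ℕ) → sum< N (λ l → g l + h l) ≡ sum< N g + sum< N h
sum<-+ zero    g h = refl
sum<-+ (suc N) g h = trans (cong (_+_ (g 0 + h 0)) (sum<-+ N (g ∘ suc) (h ∘ suc)))
                           (interchange +-commutativeSemigroup (g 0) (h 0) _ _)

count-none : ∀ N {p : ℕ → Bool} → (∀ {l} → l < N → p l ≡ false) → count N p ≡ 0
count-none zero    none = refl
count-none (suc N) none rewrite none z<s = count-none N (none ∘ s<s)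

count≡0⇒none : ∀ N (p : ℕ → Bool) → count N p ≡ 0 → ∀ {l} → l < N → p l ≡ false
count≡0⇒none (suc N) p #p≡0 {zero}  _ with p 0
... | false = refl
count≡0⇒none (suc N) p #p≡0 {suc l} (s<s l<N) =
  count≡0⇒none N (p ∘ suc) (m+n≡0⇒n≡0 (indicator (p 0)) #p≡0) l<N

count-single : ∀ {N j} → j < N → (b : Bool) → count N (λ l → (l ≡ᵇ j) ∧ b) ≡ indicator b
count-single {suc N} {zero}  _         b = trans (cong (_+_ (indicator b)) (count-none N (λ _ → refl)))
                                                 (+-identityʳ (indicator b))
count-single {suc N} {suc j} (s<s j<N) b = count-single j<N b

count-below : ∀ {N j} → j ≤ N → (p : ℕ → Bool) → count N (λ l → (l <ᵇ j) ∧ p l) ≡ count j p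
count-below {N}     {zero}  _         p = count-none N (λ _ → refl)
count-below {suc N} {suc j} (s≤s j≤N) p = cong (_+_ (indicator (p 0))) (count-below j≤N (p ∘ suc))

length-filter-applyUpTo : ∀ N (p : ℕ → Bool) (g : ℕ → ℕ) →
  length (filter (T? ∘ p) (applyUpTo g N)) ≡ count N (p ∘ g)
length-filter-applyUpTo zero    p g = refl
length-filter-applyUpTo (suc N) p g with p (g 0)
... | true  = cong suc (length-filter-applyUpTo N p (g ∘ suc))
... | false = length-filter-applyUpTo N p (g ∘ suc)

module Crossings (f : ℕ → ℕ) (N : ℕ)
                 (f-injective : ∀ {k l} → k ≤ N → l ≤ N → f k ≡ f l → k ≡ l) where

  f-≢ : ∀ {k l} → k ≤ N → l ≤ N → k ≢ l → f k ≢ f l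
  f-≢ k≤N l≤N k≢l = k≢l ∘ f-injective k≤N l≤N

  descendsThrough : ℕ → ℕ → Bool
  descendsThrough K l = (f (suc l) <ᵇ K) ∧ (K ≤ᵇ f l)

  descendsAcross : ℕ → ℕ → Bool
  descendsAcross v l = (f (suc l) <ᵇ v) ∧ (v <ᵇ f l)

  crossings : ℕ → ℕ
  crossings K = count N (descendsThrough K)

  crossingsBefore : ℕ → ℕ
  crossingsBefore j = count j (descendsAcross (f j))

  crossingsAfter : ℕ → ℕ
  crossingsAfter j = count N (λ l → (j <ᵇ l) ∧ descendsAcross (f j) l)

  descendsThrough-value : ∀ {j l} → j ≤ N → l ≤ N → l ≢ j →
                          descendsThrough (f j) l ≡ descendsAcross (f j) l
  descendsThrough-value {j} {l} j≤N l≤N l≢j =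
    cong ((f (suc l) <ᵇ f j) ∧_) (≤ᵇ-≢ (f-≢ j≤N l≤N (l≢j ∘ sym)))

  crossings-split : ∀ {j} → j < N →
    crossings (f j) ≡ crossingsBefore j + (indicator (f (suc j) <ᵇ f j) + crossingsAfter j)
  crossings-split {j} j<N = begin
    crossings (f j)
      ≡⟨ sum<-cong N pointwise ⟩
    sum< N (λ l → before l + (at l + after l))
      ≡⟨ sum<-+ N before _ ⟩
    sum< N before + sum< N (λ l → at l + after l)
      ≡⟨ cong (_+_ (sum< N before)) (sum<-+ N at after) ⟩
    sum< N before + (sum< N at + crossingsAfter j)
      ≡⟨ cong₂ (λ b a → b + (a + crossingsAfter j))
               (count-below (<⇒≤ j<N) (descendsAcross (f j))) (count-single j<N _) ⟩
    crossingsBefore j + (indicator (f (suc j) <ᵇ f j) + crossingsAfter j) ∎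
    where
    before at after : ℕ → ℕ
    before l = indicator ((l <ᵇ j) ∧ descendsAcross (f j) l)
    at     l = indicator ((l ≡ᵇ j) ∧ (f (suc j) <ᵇ f j))
    after  l = indicator ((j <ᵇ l) ∧ descendsAcross (f j) l)

    pointwise : ∀ {l} → l < N → indicator (descendsThrough (f j) l) ≡ before l + (at l + after l)
    pointwise {l} l<N with <-cmp l j
    ... | tri< l<j _ _
      rewrite <ᵇ-true l<j | ≡ᵇ-≢ (<⇒≢ l<j) | <ᵇ-false {j} {l} (<⇒≤ l<j) =
        trans (cong indicator (descendsThrough-value (<⇒≤ j<N) (<⇒≤ l<N) (<⇒≢ l<j)))
              (sym (+-identityʳ _))
    ... | tri≈ _ refl _
      rewrite <ᵇ-irrefl l | ≡ᵇ-refl l | ≤ᵇ-refl (f l) =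
        trans (cong indicator (∧-identityʳ _)) (sym (+-identityʳ _))
    ... | tri> _ _ j<l
      rewrite <ᵇ-false {l} {j} (<⇒≤ j<l) | ≡ᵇ-≢ (<⇒≢ j<l ∘ sym) | <ᵇ-true j<l =
        cong indicator (descendsThrough-value (<⇒≤ j<N) (<⇒≤ l<N) (<⇒≢ j<l ∘ sym))

  crossings-step : ∀ {x} → suc x < N →
    indicator (f (suc (suc x)) <ᵇ f (suc x)) + crossings (suc (f (suc x)))
      ≡ indicator (f (suc x) <ᵇ f x) + crossings (f (suc x))
  crossings-step {x} 1+x<N = begin
    indicator leaves + crossings (suc v)
      ≡⟨ +-comm (indicator leaves) _ ⟩
    crossings (suc v) + indicator leaves
      ≡⟨ cong (_+_ (crossings (suc v))) (count-single 1+x<N leaves) ⟨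
    crossings (suc v) + count N (λ l → (l ≡ᵇ suc x) ∧ leaves)
      ≡⟨ sum<-+ N _ _ ⟨
    sum< N (λ l → indicator (descendsThrough (suc v) l) + indicator ((l ≡ᵇ suc x) ∧ leaves))
      ≡⟨ sum<-cong N pointwise ⟩
    sum< N (λ l → indicator (descendsThrough v l) + indicator ((l ≡ᵇ x) ∧ enters))
      ≡⟨ sum<-+ N _ _ ⟩
    crossings v + count N (λ l → (l ≡ᵇ x) ∧ enters)
      ≡⟨ cong (_+_ (crossings v)) (count-single (<-trans (n<1+n x) 1+x<N) enters) ⟩
    crossings v + indicator enters
      ≡⟨ +-comm (crossings v) _ ⟩
    indicator enters + crossings v ∎
    where
    v : ℕ
    v = f (suc x)

    enters leaves : Bool
    enters = v <ᵇ f x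
    leaves = f (suc (suc x)) <ᵇ v

    -- Raising the level from v to v + 1 only affects the two steps x and x + 1 touching f = v.
    pointwise : ∀ {l} → l < N →
      indicator (descendsThrough (suc v) l) + indicator ((l ≡ᵇ suc x) ∧ leaves)
        ≡ indicator (descendsThrough v l) + indicator ((l ≡ᵇ x) ∧ enters)
    pointwise {l} l<N with l ≟ x | l ≟ suc x
    ... | yes refl | _
      rewrite ≡ᵇ-refl l | ≡ᵇ-≢ {l} {suc l} (<⇒≢ (n<1+n l)) | <ᵇ-true (n<1+n v) | <ᵇ-irrefl v =
        +-comm (indicator enters) 0
    ... | no _ | yes refl
      rewrite ≡ᵇ-refl l | ≡ᵇ-≢ {l} {x} (<⇒≢ (n<1+n x) ∘ sym) | <ᵇ-irrefl v
            | ∧-zeroʳ (f (suc l) <ᵇ suc v) | ≤ᵇ-refl v | ∧-identityʳ leaves =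
        sym (+-identityʳ (indicator leaves))
    ... | no l≢x | no l≢1+x
      rewrite ≡ᵇ-≢ l≢x | ≡ᵇ-≢ l≢1+x
            | <ᵇ-suc (f (suc l)) v | ≤ᵇ-≢ (f-≢ l<N (<⇒≤ 1+x<N) (l≢x ∘ suc-injective)) =
        cong (λ b → indicator ((f (suc l) <ᵇ v) ∧ b) + 0)
             (sym (≤ᵇ-≢ (f-≢ (<⇒≤ 1+x<N) (<⇒≤ l<N) (l≢1+x ∘ sym))))

  RightToLeftMinimum : ℕ → Set
  RightToLeftMinimum j = ∀ {l} → j ≤ l → l ≤ N → f j ≤ f l

  rightToLeftMinimum⇔ : ∀ {j} → j < N →
    RightToLeftMinimum j ⇔ (f j < f (suc j) × crossingsAfter j ≡ 0)
  rightToLeftMinimum⇔ {j} j<N = mk⇔ to from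
    where
    to : RightToLeftMinimum j → f j < f (suc j) × crossingsAfter j ≡ 0
    to minimum = ascent , count-none N noneAfter
      where
      ascent : f j < f (suc j)
      ascent = ≤∧≢⇒< (minimum (n≤1+n j) j<N) (f-≢ (<⇒≤ j<N) j<N (<⇒≢ (n<1+n j)))

      noneAfter : ∀ {l} → l < N → ((j <ᵇ l) ∧ descendsAcross (f j) l) ≡ false
      noneAfter {l} l<N with j <? l
      ... | no  j≮l rewrite <ᵇ-false (≮⇒≥ j≮l) = refl
      ... | yes j<l rewrite <ᵇ-false (minimum (<⇒≤ (m<n⇒m<1+n j<l)) l<N) = ∧-zeroʳ (j <ᵇ l)

    from : f j < f (suc j) × crossingsAfter j ≡ 0 → RightToLeftMinimum j
    from (ascent , noneAfter) = minimum
      where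
      stays-above : ∀ {l} → j < l → l < N → f j ≤ f l → f j ≤ f (suc l)
      stays-above {l} j<l l<N fj≤fl = <ᵇ-false⇒≥ (begin
        f (suc l) <ᵇ f j                                 ≡⟨ ∧-identityʳ _ ⟨
        (f (suc l) <ᵇ f j) ∧ true                        ≡⟨ cong ((f (suc l) <ᵇ f j) ∧_) (<ᵇ-true fj<fl) ⟨
        descendsAcross (f j) l                           ≡⟨ cong (_∧ descendsAcross (f j) l) (<ᵇ-true j<l) ⟨
        (j <ᵇ l) ∧ descendsAcross (f j) l                ≡⟨ count≡0⇒none N _ noneAfter l<N ⟩
        false                                            ∎)
        where
        fj<fl : f j < f l
        fj<fl = ≤∧≢⇒< fj≤fl (f-≢ (<⇒≤ j<N) (<⇒≤ l<N) (<⇒≢ j<l))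

      minimum : RightToLeftMinimum j
      minimum {zero}  z≤n _ = ≤-refl
      minimum {suc l} j≤1+l 1+l≤N with m≤n⇒m<n∨m≡n j≤1+l
      ... | inj₂ refl = ≤-refl
      ... | inj₁ (s≤s j≤l) with m≤n⇒m<n∨m≡n j≤l
      ...   | inj₂ refl = <⇒≤ ascent
      ...   | inj₁ j<l  = stays-above j<l 1+l≤N (minimum j≤l (<⇒≤ 1+l≤N))

-- kindAt σ j unfolds to peakShape (ext σ (j ∸ 1)) (ext σ j) (ext σ (suc j)).
peakShape : ℕ → ℕ → ℕ → Step
peakShape a b c =
  if (a <ᵇ b) ∧ (c <ᵇ b) then down
  else if (b <ᵇ a) ∧ (b <ᵇ c) then up
  else flat

stepΔ-peakShape : ∀ {a b c} → a ≢ b → c ≢ b → ∀ {D D′} →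
  indicator (c <ᵇ b) + D′ ≡ indicator (b <ᵇ a) + D → + D′ ≡ + D ℤ.+ stepΔ (peakShape a b c)
stepΔ-peakShape {a} {b} {c} a≢b c≢b {D} {D′} balance with <-cmp a b | <-cmp c b
... | tri≈ _ a≡b _ | _ = ⊥-elim (a≢b a≡b)
... | _ | tri≈ _ c≡b _ = ⊥-elim (c≢b c≡b)
... | tri< a<b _ _ | tri< c<b _ _
  rewrite <ᵇ-true a<b | <ᵇ-true c<b | <ᵇ-false {b} {a} (<⇒≤ a<b) | sym balance = refl
... | tri< a<b _ _ | tri> _ _ b<c
  rewrite <ᵇ-true a<b | <ᵇ-false {c} {b} (<⇒≤ b<c) | <ᵇ-false {b} {a} (<⇒≤ a<b) | balance =
    sym (ℤₚ.+-identityʳ (+ D))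
... | tri> _ _ b<a | tri< c<b _ _
  rewrite <ᵇ-false {a} {b} (<⇒≤ b<a) | <ᵇ-true c<b | <ᵇ-true b<a | <ᵇ-false {b} {c} (<⇒≤ c<b)
        | suc-injective balance =
    sym (ℤₚ.+-identityʳ (+ D))
... | tri> _ _ b<a | tri> _ _ b<c
  rewrite <ᵇ-false {a} {b} (<⇒≤ b<a) | <ᵇ-false {c} {b} (<⇒≤ b<c) | <ᵇ-true b<a | <ᵇ-true b<c
        | balance = cong +_ (+-comm 1 D)

height : List Step → ℤ
height = foldr (λ s h → stepΔ s ℤ.+ h) (+ 0)

height-take-tabulate : ∀ {m} (g : Fin m → Step) (h : ℕ → ℤ) →
  (∀ {t} (t<m : t < m) → h (suc t) ≡ h t ℤ.+ stepΔ (g (fromℕ< t<m))) →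
  ∀ {t} → t ≤ m → h 0 ℤ.+ height (take t (tabulate g)) ≡ h t
height-take-tabulate g h steps {zero} _ = ℤₚ.+-identityʳ (h 0)
height-take-tabulate {suc m} g h steps {suc t} (s≤s t≤m) = begin
  h 0 ℤ.+ (stepΔ (g fzero) ℤ.+ height (take t (tabulate (g ∘ fsuc))))
    ≡⟨ ℤₚ.+-assoc (h 0) _ _ ⟨
  (h 0 ℤ.+ stepΔ (g fzero)) ℤ.+ height (take t (tabulate (g ∘ fsuc)))
    ≡⟨ cong (ℤ._+ height (take t (tabulate (g ∘ fsuc)))) (steps z<s) ⟨
  h 1 ℤ.+ height (take t (tabulate (g ∘ fsuc)))
    ≡⟨ height-take-tabulate (g ∘ fsuc) (h ∘ suc) (steps ∘ s<s) t≤m ⟩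
  h (suc t) ∎

module _ {n : ℕ} (σ : Permutation′ n) where

  ext-suc-fromℕ< : ∀ {y} (y<n : y < n) → ext σ (suc y) ≡ suc (toℕ (σ ⟨$⟩ʳ fromℕ< y<n))
  ext-suc-fromℕ< {y} y<n with y <? n
  ... | yes _   = refl
  ... | no  y≮n = ⊥-elim (y≮n y<n)

  ext-suc-toℕ : (x : Fin n) → ext σ (suc (toℕ x)) ≡ suc (toℕ (σ ⟨$⟩ʳ x))
  ext-suc-toℕ x = trans (ext-suc-fromℕ< (toℕ<n x)) (cong (λ y → suc (toℕ (σ ⟨$⟩ʳ y))) (fromℕ<-toℕ x _))

  ext-last : ext σ (suc n) ≡ suc n
  ext-last with n <? n
  ... | yes n<n = ⊥-elim (n≮n n n<n)
  ... | no  _   = refl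

  ext-suc-positive : ∀ l → 0 < ext σ (suc l)
  ext-suc-positive l with l <? n
  ... | yes _ = z<s
  ... | no  _ = z<s

  ext-suc-<-last : ∀ {y} → y < n → ext σ (suc y) < ext σ (suc n)
  ext-suc-<-last y<n rewrite ext-suc-fromℕ< y<n | ext-last = s<s (toℕ<n _)

  ext-posOf : ∀ i → ext σ (posOf σ i) ≡ suc (toℕ i)
  ext-posOf i = trans (ext-suc-toℕ (σ ⟨$⟩ˡ i)) (cong (suc ∘ toℕ) (inverseʳ σ))

module _ {n : ℕ} (σ : Permutation′ n) where

  ext-inverse : ∀ {k} → k ≤ suc n → ext (flip σ) (ext σ k) ≡ k
  ext-inverse {zero}  _       = refl
  ext-inverse {suc y} y≤n with m≤n⇒m<n∨m≡n (s≤s⁻¹ y≤n)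
  ... | inj₂ refl = trans (cong (ext (flip σ)) (ext-last σ)) (ext-last (flip σ))
  ... | inj₁ y<n  = begin
    ext (flip σ) (ext σ (suc y))                        ≡⟨ cong (ext (flip σ)) (ext-suc-fromℕ< σ y<n) ⟩
    ext (flip σ) (suc (toℕ (σ ⟨$⟩ʳ fromℕ< y<n)))         ≡⟨ ext-suc-toℕ (flip σ) _ ⟩
    suc (toℕ (σ ⟨$⟩ˡ (σ ⟨$⟩ʳ fromℕ< y<n)))               ≡⟨ cong (suc ∘ toℕ) (inverseˡ σ) ⟩
    suc (toℕ (fromℕ< y<n))                              ≡⟨ cong suc (toℕ-fromℕ< y<n) ⟩
    suc y                                               ∎

  ext-injective : ∀ {k l} → k ≤ suc n → l ≤ suc n → ext σ k ≡ ext σ l → k ≡ l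
  ext-injective {k} {l} k≤ l≤ fk≡fl = begin
    k                          ≡⟨ ext-inverse k≤ ⟨
    ext (flip σ) (ext σ k)     ≡⟨ cong (ext (flip σ)) fk≡fl ⟩
    ext (flip σ) (ext σ l)     ≡⟨ ext-inverse l≤ ⟩
    l                          ∎

  open Crossings (ext σ) (suc n) ext-injective public

  ascentAt⇔ : ∀ {x} → x < n → ascentAt σ (suc x) ≡ true ⇔ ext σ (suc x) < ext σ (suc (suc x))
  ascentAt⇔ {x} x<n with suc x ≟ n
  ... | no  1+x≢n rewrite ≡ᵇ-≢ 1+x≢n = <ᵇ⇔<
  ... | yes 1+x≡n = mk⇔
    (λ _ → subst (λ k → ext σ (suc x) < ext σ (suc k)) (sym 1+x≡n) (ext-suc-<-last σ x<n))
    (λ _ → cong (_∨ (ext σ (suc x) <ᵇ ext σ (suc (suc x)))) (dec-true (suc x ≟ n) 1+x≡n))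

  mAt≡crossingsBefore : ∀ j → mAt σ j ≡ crossingsBefore j
  mAt≡crossingsBefore j =
    trans (length-filter-applyUpTo j _ id) (sum<-cong j (cong indicator ∘ pointwise))
    where
    -- The side conditions 1 ≤ l and l + 1 < j of mAt are automatic: f 0 = 0, and the step
    -- j − 1 → j cannot descend across f j.
    pointwise : ∀ {l} → l < j →
      (0 <ᵇ l) ∧ (suc l <ᵇ j) ∧ descendsAcross (ext σ j) l ≡ descendsAcross (ext σ j) l
    pointwise {zero}  _ = sym (∧-zeroʳ _)
    pointwise {suc l} 2+l≤j with m≤n⇒m<n∨m≡n 2+l≤j
    ... | inj₁ 2+l<j rewrite <ᵇ-true 2+l<j = refl
    ... | inj₂ refl  rewrite <ᵇ-irrefl (suc (suc l)) | <ᵇ-irrefl (ext σ (suc (suc l))) = refl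

  crossings-one : crossings 1 ≡ 0
  crossings-one = count-none (suc n) (λ {l} _ →
    cong (_∧ (1 ≤ᵇ ext σ l)) (<ᵇ-false (ext-suc-positive σ l)))

  crossings-suc-value : ∀ {x} → x < n →
    + crossings (suc (ext σ (suc x))) ≡ + crossings (ext σ (suc x)) ℤ.+ stepΔ (kindAt σ (suc x))
  crossings-suc-value {x} x<n = stepΔ-peakShape
    (f-≢ (m≤n⇒m≤1+n (<⇒≤ x<n)) (m≤n⇒m≤1+n x<n) (<⇒≢ (n<1+n x)))
    (f-≢ (s≤s x<n) (m≤n⇒m≤1+n x<n) (<⇒≢ (n<1+n (suc x)) ∘ sym))
    (crossings-step (s<s x<n))

  heightBefore≡crossings : ∀ k → heightBefore σ k ≡ + crossings (suc (toℕ k))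
  heightBefore≡crossings k = begin
    heightBefore σ k
      ≡⟨ cong (height ∘ take (toℕ k)) (map-tabulate id kind) ⟩
    height (take (toℕ k) (tabulate kind))
      ≡⟨ ℤₚ.+-identityˡ _ ⟨
    + 0 ℤ.+ height (take (toℕ k) (tabulate kind))
      ≡⟨ cong (λ c → + c ℤ.+ height (take (toℕ k) (tabulate kind))) crossings-one ⟨
    + crossings 1 ℤ.+ height (take (toℕ k) (tabulate kind))
      ≡⟨ height-take-tabulate kind (λ t → + crossings (suc t)) step (<⇒≤ (toℕ<n k)) ⟩
    + crossings (suc (toℕ k)) ∎
    where
    kind : Fin n → Step
    kind k = kindAt σ (posOf σ k)

    step : ∀ {t} (t<n : t < n) → + crossings (suc (suc t)) ≡ + crossings (suc t) ℤ.+ stepΔ (kind (fromℕ< t<n))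
    step t<n = subst (λ v → + crossings (suc v) ≡ + crossings v ℤ.+ stepΔ (kind (fromℕ< t<n)))
                     (trans (ext-posOf σ (fromℕ< t<n)) (cong suc (toℕ-fromℕ< t<n)))
                     (crossings-suc-value (toℕ<n (σ ⟨$⟩ˡ fromℕ< t<n)))

  heightBefore-at-ascent : ∀ i → let j = posOf σ i in ext σ j < ext σ (suc j) →
    heightBefore σ i ≡ + (mAt σ j + crossingsAfter j)
  heightBefore-at-ascent i ascent = begin
    heightBefore σ i
      ≡⟨ heightBefore≡crossings i ⟩
    + crossings (suc (toℕ i))
      ≡⟨ cong (+_ ∘ crossings) (ext-posOf σ i) ⟨
    + crossings (ext σ j)
      ≡⟨ cong +_ (crossings-split (s<s (toℕ<n (σ ⟨$⟩ˡ i)))) ⟩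
    + (crossingsBefore j + (indicator (ext σ (suc j) <ᵇ ext σ j) + crossingsAfter j))
      ≡⟨ cong₂ (λ m b → + (m + (indicator b + crossingsAfter j)))
               (mAt≡crossingsBefore j) (sym (<ᵇ-false (<⇒≤ ascent))) ⟨
    + (mAt σ j + crossingsAfter j) ∎
    where
    j : ℕ
    j = posOf σ i

  isType1⇔ : ∀ i → let j = posOf σ i in
    IsType1 σ i ⇔ (ext σ j < ext σ (suc j) × crossingsAfter j ≡ 0)
  isType1⇔ i = mk⇔
    (λ (asc , m≡h) → let ascent = to asc in
      ascent , Equivalence.to +m≡+[m+r]⇔r≡0 (trans m≡h (heightBefore-at-ascent i ascent)))
    (λ (ascent , none) →
      from ascent , trans (Equivalence.from +m≡+[m+r]⇔r≡0 none) (sym (heightBefore-at-ascent i ascent)))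
    where
    open Equivalence (ascentAt⇔ (toℕ<n (σ ⟨$⟩ˡ i)))

  isRLMin⇔ : ∀ p → IsRLMin σ p ⇔ RightToLeftMinimum (suc (toℕ p))
  isRLMin⇔ p = mk⇔ to from
    where
    to : IsRLMin σ p → RightToLeftMinimum (suc (toℕ p))
    to minimum {suc y} (s≤s p≤y) y≤n with m≤n⇒m<n∨m≡n (s≤s⁻¹ y≤n)
    ... | inj₂ refl = <⇒≤ (ext-suc-<-last σ (toℕ<n p))
    ... | inj₁ y<n  = subst₂ _≤_ (sym (ext-suc-toℕ σ p)) (sym (ext-suc-fromℕ< σ y<n))
                        (s≤s (minimum (fromℕ< y<n) (subst (toℕ p ≤_) (sym (toℕ-fromℕ< y<n)) p≤y)))

    from : RightToLeftMinimum (suc (toℕ p)) → IsRLMin σ p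
    from minimum l p≤l = s≤s⁻¹ (subst₂ _≤_ (ext-suc-toℕ σ p) (ext-suc-toℕ σ l)
                                  (minimum (s≤s p≤l) (m≤n⇒m≤1+n (toℕ<n l))))

lemma3p10 : (n : ℕ) (σ : Permutation′ n) (i : Fin n) →
    IsRLMin σ (σ ⟨$⟩ˡ i) ⇔ IsType1 σ i
lemma3p10 n σ i =
  ⇔.trans (isRLMin⇔ σ p)
  (⇔.trans (rightToLeftMinimum⇔ σ (s<s (toℕ<n p)))
           (⇔.sym (isType1⇔ σ i)))
  where
  p : Fin n
  p = σ ⟨$⟩ˡ i
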